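{- Let $P$ be a finite poset and $m$ a positive integer. Then the probability distribution $\Omega^{(m)}_{J(P)}$ on the distributive lattice $J(P)$ is toggle-symmetric.
   Context: $J(P)$ is the set of order ideals (down-closed subsets) of $P$, ordered by inclusion. For a finite poset $Q$ and positive integer $m$, $\Omega^{(m)}_Q$ is the probability distribution on $Q$ assigning to $q$ probability proportional to the number of $m$-element multichains $q_1\le q_2\le\cdots\le q_m$ in $Q$ that pass through $q$ (i.e. $q=q_k$ for some $k$). For $A\subseteq P$, $\max(A)$ and $\min(A)$ denote the sets of $P$-maximal and $P$-minimal elements of $A$. A probability distribution on $J(P)$ is toggle-symmetric if for every $p\in P$, the probability of the event $p\in\max(I)$ equals the probability of the event $p\in\min(P\setminus I)$, where $I$ is the random order ideal. -}

module Defs where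

open import Level using (0ℓ)
open import Data.Nat using (ℕ; zero; suc)
open import Data.Bool using (Bool; true; false)
open import Data.Fin using (Fin)
open import Data.Fin.Properties using (all?; any?) renaming (_≟_ to _≟F_)
open import Data.Fin.Subset using (Subset; _∈_; _∉_; _⊆_)
open import Data.Fin.Subset.Properties using (_∈?_; _⊆?_)
open import Data.Vec using (Vec; []; _∷_)
open import Data.Vec.Relation.Unary.All as VAll using ()
open import Data.Vec.Relation.Unary.Any as VAny using ()
open import Data.Vec.Properties using (≡-dec)
open import Data.List using (List; []; _∷_; map; concatMap; filter; foldr; length)
open import Data.Product using (_×_; _,_)
open import Data.Unit using (⊤; tt)
open import Data.Integer using (+_)
open import Data.Rational using (ℚ; 0ℚ; _+_; _/_)
open import Relation.Binary using (Rel; IsDecPartialOrder)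
open import Relation.Binary.PropositionalEquality using (_≡_)
open import Relation.Nullary using (Dec; yes; ¬_; ¬?; _×-dec_; _→-dec_)
import Data.Bool.Properties as BoolP

allSubsets : (n : ℕ) → List (Subset n)
allSubsets zero = [] ∷ []
allSubsets (suc n) = concatMap (λ s → (false ∷ s) ∷ (true ∷ s) ∷ []) (allSubsets n)

allVecs : {A : Set} → List A → (m : ℕ) → List (Vec A m)
allVecs xs zero = [] ∷ []
allVecs xs (suc m) = concatMap (λ v → map (λ x → x ∷ v) xs) (allVecs xs m)

sumℚ : List ℚ → ℚ
sumℚ = foldr _+_ 0ℚ

-- ℕ-quotient as a rational; the zero-denominator case never occurs below
-- (the total weight is ≥ 1 since ∅ ⊆ ... ⊆ ∅ is a multichain).
_/ℕ_ : ℕ → ℕ → ℚ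
a /ℕ zero = 0ℚ
a /ℕ suc k = (+ a) / suc k

_≟S_ : ∀ {n} (s t : Subset n) → Dec (s ≡ t)
_≟S_ = ≡-dec BoolP._≟_

module Poset {n : ℕ} {_≼_ : Rel (Fin n) 0ℓ}
             (po : IsDecPartialOrder _≡_ _≼_) where

  open IsDecPartialOrder po using (_≤?_)

  IsIdeal : Subset n → Set
  IsIdeal S = ∀ x y → y ≼ x → x ∈ S → y ∈ S

  isIdeal? : ∀ S → Dec (IsIdeal S)
  isIdeal? S = all? λ x → all? λ y → (y ≤? x) →-dec ((x ∈? S) →-dec (y ∈? S))

  J : List (Subset n)
  J = filter isIdeal? (allSubsets n)

  IsWeakChain : ∀ {m} → Vec (Subset n) m → Set
  IsWeakChain [] = ⊤
  IsWeakChain (x ∷ []) = ⊤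
  IsWeakChain (x ∷ y ∷ r) = x ⊆ y × IsWeakChain (y ∷ r)

  isWeakChain? : ∀ {m} (v : Vec (Subset n) m) → Dec (IsWeakChain v)
  isWeakChain? [] = yes tt
  isWeakChain? (x ∷ []) = yes tt
  isWeakChain? (x ∷ y ∷ r) = (x ⊆? y) ×-dec isWeakChain? (y ∷ r)

  IsMultichainThrough : ∀ {m} → Subset n → Vec (Subset n) m → Set
  IsMultichainThrough I c = VAll.All IsIdeal c × IsWeakChain c × VAny.Any (I ≡_) c

  isMultichainThrough? : ∀ {m} I (c : Vec (Subset n) m) → Dec (IsMultichainThrough I c)
  isMultichainThrough? I c =
    VAll.all? isIdeal? c ×-dec (isWeakChain? c ×-dec VAny.any? (I ≟S_) c)

  weight : (m : ℕ) → Subset n → ℕ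
  weight m I = length (filter (isMultichainThrough? I) (allVecs J m))

  totalWeight : ℕ → ℕ
  totalWeight m = foldr (λ I acc → weight m I Data.Nat.+ acc) 0 J

  Ω : (m : ℕ) → Subset n → ℚ
  Ω m I = weight m I /ℕ totalWeight m

  IsMaxOf : Fin n → Subset n → Set
  IsMaxOf p I = p ∈ I × (∀ q → q ∈ I → p ≼ q → p ≡ q)

  isMaxOf? : ∀ p I → Dec (IsMaxOf p I)
  isMaxOf? p I = (p ∈? I) ×-dec all? (λ q → (q ∈? I) →-dec ((p ≤? q) →-dec (p ≟F q)))

  IsMinOfCompl : Fin n → Subset n → Set
  IsMinOfCompl p I = p ∉ I × (∀ q → q ∉ I → q ≼ p → q ≡ p)

  isMinOfCompl? : ∀ p I → Dec (IsMinOfCompl p I)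
  isMinOfCompl? p I = ¬? (p ∈? I) ×-dec all? (λ q → ¬? (q ∈? I) →-dec ((q ≤? p) →-dec (q ≟F p)))

  ToggleSymmetric : (Subset n → ℚ) → Set
  ToggleSymmetric μ = ∀ p →
    sumℚ (map μ (filter (isMaxOf? p) J)) ≡ sumℚ (map μ (filter (isMinOfCompl? p) J))

-- Let F_m(I) count the pairs (c, k) of an m-multichain c of J(P) and a position k with c_k = I.
-- A position is either the last occurrence of its ideal, or it is followed by a repetition whose
-- deletion leaves an (m-1)-multichain; hence F_m(I) = w_m(I) + F_{m-1}(I), where w_m(I) is the
-- number of multichains through I, and it suffices to prove
--   Σ_{p ∈ max I} F_m(I) = Σ_{p ∈ min(P∖I)} F_m(I).
-- Both sides are computed by recursion on the least element of the chain, for chains above an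
-- ideal y ∌ p. The toggle I ↦ I ∖ {p} matches the ideals with p maximal to those with p minimal in
-- the complement, and the two recursions agree because of one identity: for p ∈ max x, the
-- multichains above x ∖ {p} are those above x together with one extra chain for each pair (c, k)
-- of a multichain above x and a position at which p is maximal (remove p from c_1, …, c_k).

module Submission where

open import Defs
open import Level using (0ℓ)
open import Data.Nat using (ℕ; _≥_)
open import Data.Fin using (Fin)
open import Relation.Binary using (Rel; IsDecPartialOrder)
open import Relation.Binary.PropositionalEquality using (_≡_)

open import Data.Nat using (zero; suc; _+_)
open import Data.Nat.Properties using (+-identityʳ; +-assoc; +-comm; +-cancelʳ-≡; +-commutativeSemigroup)
open import Algebra.Properties.CommutativeSemigroup +-commutativeSemigroup using (interchange)
open import Data.Bool using (true; false; not; if_then_else_)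
open import Data.Bool.Properties using (not-involutive)
open import Data.Empty using (⊥-elim)
open import Data.Fin using () renaming (zero to fzero; suc to fsuc)
open import Data.Fin.Properties using () renaming (_≟_ to _≟ᶠ_)
open import Data.Fin.Subset using (Subset; _∈_; _∉_; _⊆_; ⊥)
open import Data.Fin.Subset.Properties using (_∈?_; _⊆?_; ⊆-trans; ⊆-antisym; ⊆-min; ∉⊥)
open import Data.List using (List; []; _∷_; _++_; map; concatMap; filter; length)
open import Data.List.Membership.Propositional using () renaming (_∈_ to _∈ₗ_)
open import Data.List.Membership.Propositional.Properties using (∈-filter⁻)
open import Data.List.Relation.Unary.Any using (here; there)
open import Data.Integer as ℤ using () renaming (+_ to pos)
import Data.Integer.Properties as ℤ
open import Data.Rational as ℚ using (0ℚ; toℚᵘ; fromℚᵘ)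
open import Data.Rational.Properties using (fromℚᵘ-cong; toℚᵘ-homo-+; toℚᵘ-fromℚᵘ; fromℚᵘ-toℚᵘ; 0/n≡0; +-identityˡ)
open import Data.Rational.Unnormalised as ℚᵘ using (mkℚᵘ; *≡*)
import Data.Rational.Unnormalised.Properties as ℚᵘ
open import Data.Vec using (Vec; []; _∷_; count; updateAt; here; there)
open import Data.Vec.Properties using (updateAt-updateAt; updateAt-cong; updateAt-id; updateAt-updates; updateAt-minimal; []=-injective)
import Data.Vec.Relation.Unary.All as All
import Data.Vec.Relation.Unary.Any as Any
open import Data.Product using (_×_; _,_; proj₁; proj₂)
open import Function using (_∘_)
open import Function.Bundles using (_⇔_; mk⇔; Equivalence)
open import Function.Properties.Equivalence using () renaming (sym to ⇔-sym)
open import Relation.Nullary using (Dec; yes; no; ¬_; ¬?; _×-dec_; does)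
open import Relation.Binary.PropositionalEquality using (_≢_; refl; sym; trans; cong; cong₂; subst; module ≡-Reasoning)
open ≡-Reasoning
open Equivalence using (to; from)

-- The Iverson bracket: d · k = [d] k. It inspects only does d, so it computes as soon as
-- the truth value of d is known.
infixr 7 _·_
_·_ : ∀ {a} {A : Set a} → Dec A → ℕ → ℕ
d · k = if does d then k else 0

module _ {a b} {A : Set a} {B : Set b} where

  ·-cong : A ⇔ B → (d : Dec A) (e : Dec B) {k : ℕ} → d · k ≡ e · k
  ·-cong _   (yes _) (yes _) = refl
  ·-cong A⇔B (yes a) (no ¬b) = ⊥-elim (¬b (to A⇔B a))
  ·-cong A⇔B (no ¬a) (yes b) = ⊥-elim (¬a (from A⇔B b))
  ·-cong _   (no _)  (no _)  = refl

  ·-× : (d : Dec A) (e : Dec B) {k : ℕ} → (d ×-dec e) · k ≡ d · e · k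
  ·-× (yes _) _ = refl
  ·-× (no _)  _ = refl

  ·-comm : (d : Dec A) (e : Dec B) {k : ℕ} → d · e · k ≡ e · d · k
  ·-comm (yes _) (yes _) = refl
  ·-comm (yes _) (no _)  = refl
  ·-comm (no _)  (yes _) = refl
  ·-comm (no _)  (no _)  = refl

  ·-split : (d : Dec A) (e : Dec B) {k : ℕ} → d · k ≡ (d ×-dec e) · k + d · ¬? e · k
  ·-split (yes _) (yes _) = sym (+-identityʳ _)
  ·-split (yes _) (no _)  = refl
  ·-split (no _)  _       = refl

··-cong : ∀ {a b c d} {A : Set a} {B : Set b} {C : Set c} {D : Set d} → (A × B) ⇔ (C × D) →
          (a? : Dec A) (b? : Dec B) (c? : Dec C) (d? : Dec D) {k : ℕ} → a? · b? · k ≡ c? · d? · k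
··-cong AB⇔CD a? b? c? d? = trans (sym (·-× a? b?)) (trans (·-cong AB⇔CD (a? ×-dec b?) (c? ×-dec d?)) (·-× c? d?))

module _ {a} {A : Set a} where

  ·-congʳ : (d : Dec A) {k l : ℕ} → (A → k ≡ l) → d · k ≡ d · l
  ·-congʳ (yes a) k≡l = k≡l a
  ·-congʳ (no _)  _   = refl

  ·-+ : (d : Dec A) {k l : ℕ} → d · (k + l) ≡ d · k + d · l
  ·-+ (yes _) = refl
  ·-+ (no _)  = refl

  ·-zeroʳ : (d : Dec A) → d · 0 ≡ 0
  ·-zeroʳ (yes _) = refl
  ·-zeroʳ (no _)  = refl

  ·-yes : A → (d : Dec A) {k : ℕ} → d · k ≡ k
  ·-yes _ (yes _) = refl
  ·-yes a (no ¬a) = ⊥-elim (¬a a)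

  ·-no : ¬ A → (d : Dec A) {k : ℕ} → d · k ≡ 0
  ·-no ¬a (yes a) = ⊥-elim (¬a a)
  ·-no _  (no _)  = refl

∑ : ∀ {a} {A : Set a} → List A → (A → ℕ) → ℕ
∑ []       f = 0
∑ (x ∷ xs) f = f x + ∑ xs f

∑-syntax : ∀ {a} {A : Set a} → List A → (A → ℕ) → ℕ
∑-syntax = ∑
infix 5 ∑-syntax
syntax ∑-syntax xs (λ x → e) = ∑[ x ∈ xs ] e

module _ {a} {A : Set a} where

  ∑-cong : (xs : List A) {f g : A → ℕ} → (∀ {x} → x ∈ₗ xs → f x ≡ g x) → ∑ xs f ≡ ∑ xs g
  ∑-cong []       _   = refl
  ∑-cong (x ∷ xs) f≗g = cong₂ _+_ (f≗g (here refl)) (∑-cong xs (f≗g ∘ there))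

  ∑-zero : (xs : List A) → ∑[ x ∈ xs ] 0 ≡ 0
  ∑-zero []       = refl
  ∑-zero (x ∷ xs) = ∑-zero xs

  ∑-+ : (xs : List A) (f g : A → ℕ) → ∑[ x ∈ xs ] (f x + g x) ≡ ∑ xs f + ∑ xs g
  ∑-+ []       f g = refl
  ∑-+ (x ∷ xs) f g = trans (cong (f x + g x +_) (∑-+ xs f g)) (interchange (f x) (g x) _ _)

  ∑-· : ∀ {b} {B : Set b} (d : Dec B) (xs : List A) (f : A → ℕ) → ∑[ x ∈ xs ] d · f x ≡ d · ∑ xs f
  ∑-· (yes _) xs f = refl
  ∑-· (no _)  xs f = ∑-zero xs

  ∑-++ : (xs ys : List A) (f : A → ℕ) → ∑ (xs ++ ys) f ≡ ∑ xs f + ∑ ys f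
  ∑-++ []       ys f = refl
  ∑-++ (x ∷ xs) ys f = trans (cong (f x +_) (∑-++ xs ys f)) (sym (+-assoc (f x) _ _))

  ∑-filter : ∀ {p} {P : A → Set p} (P? : ∀ x → Dec (P x)) (xs : List A) (f : A → ℕ) →
             ∑ (filter P? xs) f ≡ ∑[ x ∈ xs ] P? x · f x
  ∑-filter P? []       f = refl
  ∑-filter P? (x ∷ xs) f with does (P? x)
  ... | true  = cong (f x +_) (∑-filter P? xs f)
  ... | false = ∑-filter P? xs f

  length-filter : ∀ {p} {P : A → Set p} (P? : ∀ x → Dec (P x)) (xs : List A) →
                  length (filter P? xs) ≡ ∑[ x ∈ xs ] P? x · 1
  length-filter P? []       = refl
  length-filter P? (x ∷ xs) with does (P? x)
  ... | true  = cong suc (length-filter P? xs)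
  ... | false = length-filter P? xs

module _ {a b} {A : Set a} {B : Set b} where

  ∑-map : (g : A → B) (xs : List A) (f : B → ℕ) → ∑ (map g xs) f ≡ ∑[ x ∈ xs ] f (g x)
  ∑-map g []       f = refl
  ∑-map g (x ∷ xs) f = cong (f (g x) +_) (∑-map g xs f)

  ∑-concatMap : (g : A → List B) (xs : List A) (f : B → ℕ) →
                ∑ (concatMap g xs) f ≡ ∑[ x ∈ xs ] ∑ (g x) f
  ∑-concatMap g []       f = refl
  ∑-concatMap g (x ∷ xs) f = trans (∑-++ (g x) _ f) (cong (∑ (g x) f +_) (∑-concatMap g xs f))

  ∑-swap : (xs : List A) (ys : List B) (f : A → B → ℕ) →
           ∑[ x ∈ xs ] ∑[ y ∈ ys ] f x y ≡ ∑[ y ∈ ys ] ∑[ x ∈ xs ] f x y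
  ∑-swap []       ys f = sym (∑-zero ys)
  ∑-swap (x ∷ xs) ys f = trans (cong (∑ ys (f x) +_) (∑-swap xs ys f)) (sym (∑-+ ys (f x) _))

/ℕ-+ : ∀ a b t → a /ℕ t ℚ.+ b /ℕ t ≡ (a + b) /ℕ t
/ℕ-+ a b zero    = +-identityˡ 0ℚ
/ℕ-+ a b (suc k) = trans (sym (fromℚᵘ-toℚᵘ _)) (fromℚᵘ-cong sum≃)
  where
  d : ℤ.ℤ
  d = pos (suc k)
  x y : ℚᵘ.ℚᵘ
  x = mkℚᵘ (pos a) k
  y = mkℚᵘ (pos b) k
  cross-multiplied : (pos a ℤ.* d ℤ.+ pos b ℤ.* d) ℤ.* d ≡ pos (a + b) ℤ.* (d ℤ.* d)
  cross-multiplied = begin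
    (pos a ℤ.* d ℤ.+ pos b ℤ.* d) ℤ.* d ≡⟨ cong (ℤ._* d) (sym (ℤ.*-distribʳ-+ d (pos a) (pos b))) ⟩
    (pos a ℤ.+ pos b) ℤ.* d ℤ.* d       ≡⟨ ℤ.*-assoc (pos a ℤ.+ pos b) d d ⟩
    (pos a ℤ.+ pos b) ℤ.* (d ℤ.* d)     ≡⟨ cong (ℤ._* (d ℤ.* d)) (sym (ℤ.pos-+ a b)) ⟩
    pos (a + b) ℤ.* (d ℤ.* d)           ∎
  sum≃ : toℚᵘ (fromℚᵘ x ℚ.+ fromℚᵘ y) ℚᵘ.≃ mkℚᵘ (pos (a + b)) k
  sum≃ = ℚᵘ.≃-trans (toℚᵘ-homo-+ (fromℚᵘ x) (fromℚᵘ y))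
           (ℚᵘ.≃-trans (ℚᵘ.+-cong (toℚᵘ-fromℚᵘ x) (toℚᵘ-fromℚᵘ y)) (*≡* cross-multiplied))

∑-/ℕ : ∀ {a} {A : Set a} (xs : List A) (f : A → ℕ) (t : ℕ) →
       sumℚ (map (λ x → f x /ℕ t) xs) ≡ ∑ xs f /ℕ t
∑-/ℕ []       f zero    = refl
∑-/ℕ []       f (suc k) = sym (0/n≡0 (suc k))
∑-/ℕ (x ∷ xs) f t       = trans (cong (f x /ℕ t ℚ.+_) (∑-/ℕ xs f t)) (/ℕ-+ (f x) (∑ xs f) t)

toggle : ∀ {n} → Fin n → Subset n → Subset n
toggle p s = updateAt s p not

∉⇒∈-toggle : ∀ {n} (p : Fin n) (s : Subset n) → p ∉ s → p ∈ toggle p s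
∉⇒∈-toggle fzero    (true  ∷ s) p∉s = ⊥-elim (p∉s here)
∉⇒∈-toggle fzero    (false ∷ s) _   = here
∉⇒∈-toggle (fsuc p) (b ∷ s)     p∉s = there (∉⇒∈-toggle p s (p∉s ∘ there))

module _ {n : ℕ} where

  toggle-involutive : (p : Fin n) (s : Subset n) → toggle p (toggle p s) ≡ s
  toggle-involutive p s =
    trans (updateAt-updateAt p s) (trans (updateAt-cong p not-involutive s) (updateAt-id p s))

  ∈-toggle⁺ : {p q : Fin n} {s : Subset n} → q ≢ p → q ∈ s → q ∈ toggle p s
  ∈-toggle⁺ {p} {q} {s} = updateAt-minimal q p s

  ∈-toggle⁻ : {p q : Fin n} {s : Subset n} → q ≢ p → q ∈ toggle p s → q ∈ s
  ∈-toggle⁻ {p} {q} {s} q≢p q∈s′ = subst (q ∈_) (toggle-involutive p s) (∈-toggle⁺ q≢p q∈s′)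

  ∈-toggle⇒∉ : {p : Fin n} {s : Subset n} → p ∈ toggle p s → p ∉ s
  ∈-toggle⇒∉ {p} {s} p∈s′ p∈s with () ← []=-injective p∈s′ (updateAt-updates p s p∈s)

∑-allSubsets-suc : ∀ n (G : Subset (suc n) → ℕ) →
                   ∑ (allSubsets (suc n)) G ≡ ∑[ s ∈ allSubsets n ] (G (false ∷ s) + G (true ∷ s))
∑-allSubsets-suc n G = trans (∑-concatMap _ (allSubsets n) G)
  (∑-cong (allSubsets n) λ {s} _ → cong (G (false ∷ s) +_) (+-identityʳ (G (true ∷ s))))

∑-allSubsets-toggle : ∀ {n} (p : Fin n) (G : Subset n → ℕ) →
                      ∑ (allSubsets n) G ≡ ∑[ s ∈ allSubsets n ] G (toggle p s)
∑-allSubsets-toggle {suc n} fzero G = begin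
  ∑ (allSubsets (suc n)) G                                ≡⟨ ∑-allSubsets-suc n G ⟩
  ∑[ s ∈ allSubsets n ] (G (false ∷ s) + G (true ∷ s))   ≡⟨ ∑-cong (allSubsets n) (λ {s} _ → +-comm (G (false ∷ s)) _) ⟩
  ∑[ s ∈ allSubsets n ] (G (true ∷ s) + G (false ∷ s))   ≡⟨ ∑-allSubsets-suc n (G ∘ toggle fzero) ⟨
  ∑[ s ∈ allSubsets (suc n) ] G (toggle fzero s)          ∎
∑-allSubsets-toggle {suc n} (fsuc p) G = begin
  ∑ (allSubsets (suc n)) G
    ≡⟨ ∑-allSubsets-suc n G ⟩
  ∑[ s ∈ allSubsets n ] (G (false ∷ s) + G (true ∷ s))
    ≡⟨ ∑-+ (allSubsets n) _ _ ⟩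
  (∑[ s ∈ allSubsets n ] G (false ∷ s)) + (∑[ s ∈ allSubsets n ] G (true ∷ s))
    ≡⟨ cong₂ _+_ (∑-allSubsets-toggle p (G ∘ (false ∷_))) (∑-allSubsets-toggle p (G ∘ (true ∷_))) ⟩
  (∑[ s ∈ allSubsets n ] G (false ∷ toggle p s)) + (∑[ s ∈ allSubsets n ] G (true ∷ toggle p s))
    ≡⟨ ∑-+ (allSubsets n) _ _ ⟨
  ∑[ s ∈ allSubsets n ] (G (false ∷ toggle p s) + G (true ∷ toggle p s))
    ≡⟨ ∑-allSubsets-suc n (G ∘ toggle (fsuc p)) ⟨
  ∑[ s ∈ allSubsets (suc n) ] G (toggle (fsuc p) s) ∎

∑-allSubsets-δ : ∀ {n} (t : Subset n) (G : Subset n → ℕ) → ∑[ s ∈ allSubsets n ] (s ≟S t) · G s ≡ G t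
∑-allSubsets-δ {zero}  []          G = +-identityʳ (G [])
∑-allSubsets-δ {suc n} (false ∷ t) G = trans (∑-allSubsets-suc n _)
  (trans (∑-cong (allSubsets n) (λ _ → +-identityʳ _)) (∑-allSubsets-δ t (G ∘ (false ∷_))))
∑-allSubsets-δ {suc n} (true ∷ t)  G =
  trans (∑-allSubsets-suc n _) (∑-allSubsets-δ t (G ∘ (true ∷_)))

module _ {n : ℕ} {_≼_ : Rel (Fin n) 0ℓ} (po : IsDecPartialOrder _≡_ _≼_) where

  open Poset po

  maxOf-toggle⇔minOfCompl : (p : Fin n) (s : Subset n) →
    (IsIdeal (toggle p s) × IsMaxOf p (toggle p s)) ⇔ (IsIdeal s × IsMinOfCompl p s)
  maxOf-toggle⇔minOfCompl p s = mk⇔ ⇒ ⇐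
    where
    ⇒ : IsIdeal (toggle p s) × IsMaxOf p (toggle p s) → IsIdeal s × IsMinOfCompl p s
    ⇒ (ideal′ , p∈s′ , p-max) = ideal , p∉s , p-min
      where
      p∉s : p ∉ s
      p∉s = ∈-toggle⇒∉ p∈s′
      ∈s⇒≢p : ∀ {x} → x ∈ s → x ≢ p
      ∈s⇒≢p x∈s refl = p∉s x∈s
      ideal : IsIdeal s
      ideal x y y≼x x∈s with y ≟ᶠ p
      ... | yes refl = ⊥-elim (∈s⇒≢p x∈s (sym (p-max x (∈-toggle⁺ (∈s⇒≢p x∈s) x∈s) y≼x)))
      ... | no y≢p   = ∈-toggle⁻ y≢p (ideal′ x y y≼x (∈-toggle⁺ (∈s⇒≢p x∈s) x∈s))
      p-min : ∀ q → q ∉ s → q ≼ p → q ≡ p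
      p-min q q∉s q≼p with q ≟ᶠ p
      ... | yes q≡p = q≡p
      ... | no q≢p  = ⊥-elim (q∉s (∈-toggle⁻ q≢p (ideal′ p q q≼p p∈s′)))
    ⇐ : IsIdeal s × IsMinOfCompl p s → IsIdeal (toggle p s) × IsMaxOf p (toggle p s)
    ⇐ (ideal , p∉s , p-min) = ideal′ , ∉⇒∈-toggle p s p∉s , p-max
      where
      below-p : ∀ y → y ≼ p → y ≢ p → y ∈ s
      below-p y y≼p y≢p with y ∈? s
      ... | yes y∈s = y∈s
      ... | no y∉s  = ⊥-elim (y≢p (p-min y y∉s y≼p))
      ideal′ : IsIdeal (toggle p s)
      ideal′ x y y≼x x∈s′ with y ≟ᶠ p | x ≟ᶠ p
      ... | yes refl | _        = ∉⇒∈-toggle p s p∉s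
      ... | no y≢p   | yes refl = ∈-toggle⁺ y≢p (below-p y y≼x y≢p)
      ... | no y≢p   | no x≢p   = ∈-toggle⁺ y≢p (ideal x y y≼x (∈-toggle⁻ x≢p x∈s′))
      p-max : ∀ q → q ∈ toggle p s → p ≼ q → p ≡ q
      p-max q q∈s′ p≼q with q ≟ᶠ p
      ... | yes q≡p = sym q≡p
      ... | no q≢p  = ⊥-elim (p∉s (ideal q p p≼q (∈-toggle⁻ q≢p q∈s′)))

  ∑J-cong : {F G : Subset n → ℕ} → (∀ z → IsIdeal z → F z ≡ G z) → ∑ J F ≡ ∑ J G
  ∑J-cong F≗G = ∑-cong J (λ {z} z∈J → F≗G z (proj₂ (∈-filter⁻ isIdeal? {xs = allSubsets n} z∈J)))

  ∑J-δ : ∀ {t} → IsIdeal t → (G : Subset n → ℕ) → ∑[ z ∈ J ] (z ≟S t) · G z ≡ G t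
  ∑J-δ {t} t-ideal G = begin
    ∑[ z ∈ J ] (z ≟S t) · G z
      ≡⟨ ∑-filter isIdeal? (allSubsets n) _ ⟩
    ∑[ s ∈ allSubsets n ] isIdeal? s · (s ≟S t) · G s
      ≡⟨ ∑-cong (allSubsets n) (λ {s} _ → ·-comm (isIdeal? s) (s ≟S t)) ⟩
    ∑[ s ∈ allSubsets n ] (s ≟S t) · isIdeal? s · G s
      ≡⟨ ∑-allSubsets-δ t _ ⟩
    isIdeal? t · G t
      ≡⟨ ·-yes t-ideal (isIdeal? t) ⟩
    G t ∎

  ∑J-toggle : (p : Fin n) (H : Subset n → ℕ) →
              ∑[ z ∈ J ] isMaxOf? p z · H z ≡ ∑[ z ∈ J ] isMinOfCompl? p z · H (toggle p z)
  ∑J-toggle p H = begin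
    ∑[ z ∈ J ] isMaxOf? p z · H z
      ≡⟨ ∑-filter isIdeal? (allSubsets n) _ ⟩
    ∑[ s ∈ allSubsets n ] isIdeal? s · isMaxOf? p s · H s
      ≡⟨ ∑-allSubsets-toggle p _ ⟩
    ∑[ s ∈ allSubsets n ] isIdeal? (toggle p s) · isMaxOf? p (toggle p s) · H (toggle p s)
      ≡⟨ ∑-cong (allSubsets n) (λ {s} _ → ··-cong (maxOf-toggle⇔minOfCompl p s)
           (isIdeal? (toggle p s)) (isMaxOf? p (toggle p s)) (isIdeal? s) (isMinOfCompl? p s)) ⟩
    ∑[ s ∈ allSubsets n ] isIdeal? s · isMinOfCompl? p s · H (toggle p s)
      ≡⟨ ∑-filter isIdeal? (allSubsets n) _ ⟨
    ∑[ z ∈ J ] isMinOfCompl? p z · H (toggle p z) ∎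

  ∑⊇ : Subset n → (Subset n → ℕ) → ℕ
  ∑⊇ y F = ∑[ x ∈ J ] (y ⊆? x) · F x

  infix 5 ∑⊇
  syntax ∑⊇ y (λ x → e) = ∑[ x ⊇ y ] e

  ∑⊇-cong : ∀ y {F G : Subset n → ℕ} → (∀ z → IsIdeal z → y ⊆ z → F z ≡ G z) → ∑⊇ y F ≡ ∑⊇ y G
  ∑⊇-cong y F≗G = ∑J-cong (λ z z-ideal → ·-congʳ (y ⊆? z) (F≗G z z-ideal))

  ∑⊇-+ : ∀ y (F G : Subset n → ℕ) → ∑[ z ⊇ y ] (F z + G z) ≡ ∑⊇ y F + ∑⊇ y G
  ∑⊇-+ y F G = trans (∑-cong J (λ {z} _ → ·-+ (y ⊆? z))) (∑-+ J _ _)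

  ∑⊇-zero : ∀ y → ∑[ z ⊇ y ] 0 ≡ 0
  ∑⊇-zero y = trans (∑-cong J (λ {z} _ → ·-zeroʳ (y ⊆? z))) (∑-zero J)

  weakChain-∷ : ∀ {m} x (v : Vec (Subset n) m) →
                IsWeakChain (x ∷ v) ⇔ (IsWeakChain v × All.All (x ⊆_) v)
  weakChain-∷ x []      = mk⇔ (λ _ → _ , All.[]) (λ _ → _)
  weakChain-∷ x (t ∷ r) = mk⇔
    (λ (x⊆t , chain) → chain , x⊆t All.∷ All.map (⊆-trans x⊆t) (proj₂ (to (weakChain-∷ t r) chain)))
    (λ { (chain , x⊆t All.∷ _) → x⊆t , chain })

  ChainAbove : ∀ {m} → Subset n → Vec (Subset n) m → Set
  ChainAbove y c = (All.All IsIdeal c × IsWeakChain c) × All.All (y ⊆_) c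

  chainAbove? : ∀ {m} y (c : Vec (Subset n) m) → Dec (ChainAbove y c)
  chainAbove? y c = (All.all? isIdeal? c ×-dec isWeakChain? c) ×-dec All.all? (y ⊆?_) c

  chainAbove-∷ : ∀ {m y x} {v : Vec (Subset n) m} → IsIdeal x →
                 ChainAbove y (x ∷ v) ⇔ (y ⊆ x × ChainAbove x v)
  chainAbove-∷ {x = x} {v} x-ideal = mk⇔
    (λ { ((_ All.∷ ideals , chain) , y⊆x All.∷ _) →
       let (chain′ , above) = to (weakChain-∷ x v) chain in y⊆x , (ideals , chain′) , above })
    (λ (y⊆x , (ideals , chain′) , above) →
       ((x-ideal All.∷ ideals , from (weakChain-∷ x v) (chain′ , above)) ,
        y⊆x All.∷ All.map (⊆-trans y⊆x) above))

  chainSum : (m : ℕ) → Subset n → (Vec (Subset n) m → ℕ) → ℕ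
  chainSum m y K = ∑[ c ∈ allVecs J m ] chainAbove? y c · K c

  chainSum-zero : ∀ y (K : Vec (Subset n) 0 → ℕ) → chainSum 0 y K ≡ K []
  chainSum-zero y K = +-identityʳ (K [])

  chainSum-suc : ∀ m y (K : Vec (Subset n) (suc m) → ℕ) →
                 chainSum (suc m) y K ≡ ∑[ x ⊇ y ] chainSum m x (K ∘ (x ∷_))
  chainSum-suc m y K = begin
    chainSum (suc m) y K
      ≡⟨ ∑-concatMap (λ v → map (_∷ v) J) (allVecs J m) _ ⟩
    ∑[ v ∈ allVecs J m ] ∑ (map (_∷ v) J) (λ c → chainAbove? y c · K c)
      ≡⟨ ∑-cong (allVecs J m) (λ {v} _ → ∑-map (_∷ v) J _) ⟩
    ∑[ v ∈ allVecs J m ] ∑[ x ∈ J ] chainAbove? y (x ∷ v) · K (x ∷ v)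
      ≡⟨ ∑-swap (allVecs J m) J _ ⟩
    ∑[ x ∈ J ] ∑[ v ∈ allVecs J m ] chainAbove? y (x ∷ v) · K (x ∷ v)
      ≡⟨ ∑J-cong (λ x x-ideal → trans
           (∑-cong (allVecs J m) (λ {v} _ → trans
             (·-cong (chainAbove-∷ x-ideal) (chainAbove? y (x ∷ v)) ((y ⊆? x) ×-dec chainAbove? x v))
             (·-× (y ⊆? x) (chainAbove? x v))))
           (∑-· (y ⊆? x) (allVecs J m) _)) ⟩
    ∑[ x ⊇ y ] chainSum m x (K ∘ (x ∷_)) ∎

  chainSum-cong : ∀ m y {K K′ : Vec (Subset n) m → ℕ} →
                  (∀ c → ChainAbove y c → K c ≡ K′ c) → chainSum m y K ≡ chainSum m y K′
  chainSum-cong m y K≗K′ = ∑-cong (allVecs J m) (λ {c} _ → ·-congʳ (chainAbove? y c) (K≗K′ c))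

  chainSum-+ : ∀ m y (K K′ : Vec (Subset n) m → ℕ) →
               chainSum m y (λ c → K c + K′ c) ≡ chainSum m y K + chainSum m y K′
  chainSum-+ m y K K′ =
    trans (∑-cong (allVecs J m) (λ {c} _ → ·-+ (chainAbove? y c))) (∑-+ (allVecs J m) _ _)

  chainSum-· : ∀ {b} {B : Set b} m y (d : Dec B) (K : Vec (Subset n) m → ℕ) →
               chainSum m y (λ c → d · K c) ≡ d · chainSum m y K
  chainSum-· m y d K =
    trans (∑-cong (allVecs J m) (λ {c} _ → ·-comm (chainAbove? y c) d)) (∑-· d (allVecs J m) _)

  multichainThrough⇔ : ∀ {m I} {c : Vec (Subset n) m} →
                       IsMultichainThrough I c ⇔ (ChainAbove ⊥ c × Any.Any (I ≡_) c)
  multichainThrough⇔ {c = c} = mk⇔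
    (λ (ideals , chain , occurs) → ((ideals , chain) , All.universal ⊆-min c) , occurs)
    (λ (((ideals , chain) , _) , occurs) → ideals , chain , occurs)

  #chains : ℕ → Subset n → ℕ
  #chains m y = chainSum m y (λ _ → 1)

  _∈ᵥ?_ : ∀ {m} I (c : Vec (Subset n) m) → Dec (Any.Any (I ≡_) c)
  I ∈ᵥ? c = Any.any? (I ≟S_) c

  #avoiding : ℕ → Subset n → ℕ
  #avoiding m y = chainSum m y (λ c → ¬? (y ∈ᵥ? c) · 1)

  #chains-split : ∀ m {x} → IsIdeal x → #chains (suc m) x ≡ #chains m x + #avoiding (suc m) x
  #chains-split m {x} x-ideal = begin
    #chains (suc m) x
      ≡⟨ chainSum-suc m x _ ⟩
    ∑[ z ⊇ x ] #chains m z
      ≡⟨ ∑-cong J (λ {z} _ → split-off-x z) ⟩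
    ∑[ z ∈ J ] ((z ≟S x) · #chains m z + (x ⊆? z) · ¬? (x ≟S z) · #chains m z)
      ≡⟨ ∑-+ J _ _ ⟩
    (∑[ z ∈ J ] (z ≟S x) · #chains m z) + (∑[ z ⊇ x ] ¬? (x ≟S z) · #chains m z)
      ≡⟨ cong₂ _+_ (∑J-δ x-ideal (#chains m)) (∑⊇-cong x avoiding-x) ⟩
    #chains m x + (∑[ z ⊇ x ] chainSum m z (λ v → ¬? (x ∈ᵥ? (z ∷ v)) · 1))
      ≡⟨ cong (#chains m x +_) (chainSum-suc m x _) ⟨
    #chains m x + #avoiding (suc m) x ∎
    where
    split-off-x : ∀ z → (x ⊆? z) · #chains m z
                        ≡ (z ≟S x) · #chains m z + (x ⊆? z) · ¬? (x ≟S z) · #chains m z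
    split-off-x z = trans (·-split (x ⊆? z) (x ≟S z))
      (cong (_+ (x ⊆? z) · ¬? (x ≟S z) · #chains m z)
            (·-cong (mk⇔ (sym ∘ proj₂) (λ { refl → (λ q∈x → q∈x) , refl })) ((x ⊆? z) ×-dec (x ≟S z)) (z ≟S x)))
    avoiding-x : ∀ z → IsIdeal z → x ⊆ z →
                 ¬? (x ≟S z) · #chains m z ≡ chainSum m z (λ v → ¬? (x ∈ᵥ? (z ∷ v)) · 1)
    avoiding-x z _ x⊆z = sym (trans (chainSum-cong m z (λ v (_ , above) →
        ·-cong (mk⇔ (λ x∉z∷v x≡z → x∉z∷v (Any.here x≡z)) (∉-∷ above)) (¬? (x ∈ᵥ? (z ∷ v))) (¬? (x ≟S z))))
      (chainSum-· m z (¬? (x ≟S z)) _))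
      where
      ∉-∷ : ∀ {v : Vec (Subset n) m} → All.All (z ⊆_) v → x ≢ z → ¬ Any.Any (x ≡_) (z ∷ v)
      ∉-∷ above x≢z (Any.here x≡z)  = x≢z x≡z
      ∉-∷ above x≢z (Any.there x∈v) = x≢z (⊆-antisym x⊆z (All.lookup above x∈v))

  module Occurrences {Q : Subset n → Set} (Q? : ∀ I → Dec (Q I)) where

    #positions : ℕ → Subset n → ℕ
    #positions m y = chainSum m y (count Q?)

    members : ∀ {m} → Vec (Subset n) m → ℕ
    members c = ∑[ I ∈ J ] Q? I · (I ∈ᵥ? c) · 1

    #members : ℕ → Subset n → ℕ
    #members m y = chainSum m y members

    count-∷ : ∀ {m} x (v : Vec (Subset n) m) → count Q? (x ∷ v) ≡ Q? x · 1 + count Q? v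
    count-∷ x v with does (Q? x)
    ... | true  = refl
    ... | false = refl

    members-∷ : ∀ {m x} (v : Vec (Subset n) m) → IsIdeal x →
                members (x ∷ v) ≡ Q? x · ¬? (x ∈ᵥ? v) · 1 + members v
    members-∷ {x = x} v x-ideal = begin
      ∑[ I ∈ J ] Q? I · (I ∈ᵥ? (x ∷ v)) · 1
        ≡⟨ ∑-cong J (λ {I} _ → head-or-tail I) ⟩
      ∑[ I ∈ J ] ((I ≟S x) · Q? I · ¬? (I ∈ᵥ? v) · 1 + Q? I · (I ∈ᵥ? v) · 1)
        ≡⟨ ∑-+ J _ _ ⟩
      (∑[ I ∈ J ] (I ≟S x) · Q? I · ¬? (I ∈ᵥ? v) · 1) + members v
        ≡⟨ cong (_+ members v) (∑J-δ x-ideal (λ I → Q? I · ¬? (I ∈ᵥ? v) · 1)) ⟩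
      Q? x · ¬? (x ∈ᵥ? v) · 1 + members v ∎
      where
      head-or-tail : ∀ I → Q? I · (I ∈ᵥ? (x ∷ v)) · 1
                           ≡ (I ≟S x) · Q? I · ¬? (I ∈ᵥ? v) · 1 + Q? I · (I ∈ᵥ? v) · 1
      head-or-tail I with Q? I | I ≟S x | I ∈ᵥ? v
      ... | yes _ | yes _ | yes _ = refl
      ... | yes _ | yes _ | no _  = refl
      ... | yes _ | no _  | _     = refl
      ... | no _  | yes _ | _     = refl
      ... | no _  | no _  | _     = refl

    #positions-zero : ∀ y → #positions 0 y ≡ 0
    #positions-zero y = chainSum-zero y (count Q?)

    #positions-suc : ∀ m y → #positions (suc m) y ≡ ∑[ x ⊇ y ] (Q? x · #chains m x + #positions m x)
    #positions-suc m y = trans (chainSum-suc m y (count Q?)) (∑⊇-cong y λ x _ _ → begin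
      chainSum m x (λ v → count Q? (x ∷ v))              ≡⟨ chainSum-cong m x (λ v _ → count-∷ x v) ⟩
      chainSum m x (λ v → Q? x · 1 + count Q? v)         ≡⟨ chainSum-+ m x _ _ ⟩
      chainSum m x (λ _ → Q? x · 1) + #positions m x     ≡⟨ cong (_+ #positions m x) (chainSum-· m x (Q? x) _) ⟩
      Q? x · #chains m x + #positions m x                 ∎)

    #members-zero : ∀ y → #members 0 y ≡ 0
    #members-zero y = trans (chainSum-zero y members) (trans (∑-cong J (λ {I} _ → ·-zeroʳ (Q? I))) (∑-zero J))

    #members-suc : ∀ m y → #members (suc m) y ≡ ∑[ x ⊇ y ] (Q? x · #avoiding m x + #members m x)
    #members-suc m y = trans (chainSum-suc m y members) (∑⊇-cong y λ x x-ideal _ → begin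
      chainSum m x (λ v → members (x ∷ v))                           ≡⟨ chainSum-cong m x (λ v _ → members-∷ v x-ideal) ⟩
      chainSum m x (λ v → Q? x · ¬? (x ∈ᵥ? v) · 1 + members v)       ≡⟨ chainSum-+ m x _ _ ⟩
      chainSum m x (λ v → Q? x · ¬? (x ∈ᵥ? v) · 1) + #members m x    ≡⟨ cong (_+ #members m x) (chainSum-· m x (Q? x) _) ⟩
      Q? x · #avoiding m x + #members m x                             ∎)

    #members+#positions : ∀ m y → #members (suc m) y + #positions m y ≡ #positions (suc m) y
    #members+#positions zero y = begin
      #members 1 y + #positions 0 y
        ≡⟨ cong₂ _+_ (#members-suc 0 y) (#positions-zero y) ⟩
      (∑[ x ⊇ y ] (Q? x · #avoiding 0 x + #members 0 x)) + 0
        ≡⟨ +-identityʳ _ ⟩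
      ∑[ x ⊇ y ] (Q? x · #avoiding 0 x + #members 0 x)
        ≡⟨ ∑⊇-cong y (λ x _ _ → cong₂ _+_
             (cong (Q? x ·_) (trans (chainSum-zero x (λ c → ¬? (x ∈ᵥ? c) · 1))
                                    (sym (chainSum-zero x (λ _ → 1)))))
             (trans (#members-zero x) (sym (#positions-zero x)))) ⟩
      ∑[ x ⊇ y ] (Q? x · #chains 0 x + #positions 0 x)
        ≡⟨ #positions-suc 0 y ⟨
      #positions 1 y ∎
    #members+#positions (suc m) y = begin
      #members (2 + m) y + #positions (suc m) y
        ≡⟨ cong₂ _+_ (#members-suc (suc m) y) (#positions-suc m y) ⟩
      (∑[ x ⊇ y ] (Q? x · #avoiding (suc m) x + #members (suc m) x))
        + (∑[ x ⊇ y ] (Q? x · #chains m x + #positions m x))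
        ≡⟨ ∑⊇-+ y _ _ ⟨
      ∑[ x ⊇ y ] ((Q? x · #avoiding (suc m) x + #members (suc m) x) + (Q? x · #chains m x + #positions m x))
        ≡⟨ ∑⊇-cong y regroup ⟩
      ∑[ x ⊇ y ] (Q? x · #chains (suc m) x + #positions (suc m) x)
        ≡⟨ #positions-suc (suc m) y ⟨
      #positions (2 + m) y ∎
      where
      regroup : ∀ x → IsIdeal x → y ⊆ x →
                (Q? x · #avoiding (suc m) x + #members (suc m) x) + (Q? x · #chains m x + #positions m x)
                ≡ Q? x · #chains (suc m) x + #positions (suc m) x
      regroup x x-ideal _ = begin
        (Q? x · #avoiding (suc m) x + #members (suc m) x) + (Q? x · #chains m x + #positions m x)
          ≡⟨ interchange (Q? x · #avoiding (suc m) x) _ _ _ ⟩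
        (Q? x · #avoiding (suc m) x + Q? x · #chains m x) + (#members (suc m) x + #positions m x)
          ≡⟨ cong₂ _+_ (sym (·-+ (Q? x))) (#members+#positions m x) ⟩
        Q? x · (#avoiding (suc m) x + #chains m x) + #positions (suc m) x
          ≡⟨ cong (λ k → Q? x · k + #positions (suc m) x)
               (trans (+-comm (#avoiding (suc m) x) _) (sym (#chains-split m x-ideal))) ⟩
        Q? x · #chains (suc m) x + #positions (suc m) x ∎

    #positions-vanish : ∀ m {x} → (∀ z → IsIdeal z → x ⊆ z → ¬ Q z) → #positions m x ≡ 0
    #positions-vanish zero    {x} _  = #positions-zero x
    #positions-vanish (suc m) {x} ¬Q = trans (#positions-suc m x) (trans (∑⊇-cong x vanishes) (∑⊇-zero x))
      where
      vanishes : ∀ z → IsIdeal z → x ⊆ z → Q? z · #chains m z + #positions m z ≡ 0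
      vanishes z z-ideal x⊆z = cong₂ _+_ (·-no (¬Q z z-ideal x⊆z) (Q? z))
        (#positions-vanish m (λ w w-ideal z⊆w → ¬Q w w-ideal (⊆-trans x⊆z z⊆w)))

    ∑-weight : ∀ m → ∑ (filter Q? J) (weight m) ≡ #members m ⊥
    ∑-weight m = begin
      ∑ (filter Q? J) (weight m)
        ≡⟨ ∑-filter Q? J _ ⟩
      ∑[ I ∈ J ] Q? I · weight m I
        ≡⟨ ∑-cong J (λ {I} _ → cong (Q? I ·_) (length-filter (isMultichainThrough? I) (allVecs J m))) ⟩
      ∑[ I ∈ J ] Q? I · (∑[ c ∈ allVecs J m ] isMultichainThrough? I c · 1)
        ≡⟨ ∑-cong J (λ {I} _ → ∑-· (Q? I) (allVecs J m) _) ⟨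
      ∑[ I ∈ J ] ∑[ c ∈ allVecs J m ] Q? I · isMultichainThrough? I c · 1
        ≡⟨ ∑-swap J (allVecs J m) _ ⟩
      ∑[ c ∈ allVecs J m ] ∑[ I ∈ J ] Q? I · isMultichainThrough? I c · 1
        ≡⟨ ∑-cong (allVecs J m) (λ {c} _ → trans (∑-cong J (λ {I} _ → through I c)) (∑-· (chainAbove? ⊥ c) J _)) ⟩
      #members m ⊥ ∎
      where
      through : ∀ I c → Q? I · isMultichainThrough? I c · 1 ≡ chainAbove? ⊥ c · Q? I · (I ∈ᵥ? c) · 1
      through I c = trans
        (cong (Q? I ·_) (trans
          (·-cong multichainThrough⇔ (isMultichainThrough? I c) (chainAbove? ⊥ c ×-dec I ∈ᵥ? c))
          (·-× (chainAbove? ⊥ c) (I ∈ᵥ? c))))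
        (·-comm (Q? I) (chainAbove? ⊥ c))

  module Toggle (p : Fin n) where

    module Max = Occurrences (isMaxOf? p)
    module Min = Occurrences (isMinOfCompl? p)

    maxOf-⊆ : ∀ {z w} → z ⊆ w → p ∈ z → IsMaxOf p w → IsMaxOf p z
    maxOf-⊆ z⊆w p∈z (_ , p-max) = p∈z , λ q q∈z p≼q → p-max q (z⊆w q∈z) p≼q

    ⊆-toggle⇔ : ∀ {s z} → p ∉ s → s ⊆ toggle p z ⇔ s ⊆ z
    ⊆-toggle⇔ {s} p∉s = mk⇔ (λ s⊆z′ {_} q∈s → ∈-toggle⁻ (≢p q∈s) (s⊆z′ q∈s))
                             (λ s⊆z {_} q∈s → ∈-toggle⁺ (≢p q∈s) (s⊆z q∈s))
      where
      ≢p : ∀ {q} → q ∈ s → q ≢ p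
      ≢p q∈s refl = p∉s q∈s

    ⊆⇔toggle-⊆×∈ : ∀ {x z} → p ∈ x → x ⊆ z ⇔ (toggle p x ⊆ z × p ∈ z)
    ⊆⇔toggle-⊆×∈ {x} {z} p∈x = mk⇔ (λ x⊆z → (λ {_} q∈x′ → x⊆z (∈-toggle⁻ (≢p q∈x′) q∈x′)) , x⊆z p∈x) ⊆-from
      where
      ≢p : ∀ {q} → q ∈ toggle p x → q ≢ p
      ≢p q∈x′ refl = ∈-toggle⇒∉ q∈x′ p∈x
      ⊆-from : toggle p x ⊆ z × p ∈ z → x ⊆ z
      ⊆-from (x′⊆z , p∈z) {q} q∈x with q ≟ᶠ p
      ... | yes refl = p∈z
      ... | no q≢p   = x′⊆z (∈-toggle⁺ q≢p q∈x)

    minOfCompl×⊆⇔ : ∀ {x z} → IsIdeal x → p ∈ x →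
                    (IsMinOfCompl p z × x ⊆ toggle p z) ⇔ (toggle p x ⊆ z × p ∉ z)
    minOfCompl×⊆⇔ {x} {z} x-ideal p∈x = mk⇔
      (λ ((p∉z , _) , x⊆z′) → to (⊆-toggle⇔ p∉x′) (proj₁ (to (⊆⇔toggle-⊆×∈ p∈x) x⊆z′)) , p∉z)
      (λ (x′⊆z , p∉z) → (p∉z , below-p x′⊆z) ,
         from (⊆⇔toggle-⊆×∈ p∈x) (from (⊆-toggle⇔ p∉x′) x′⊆z , ∉⇒∈-toggle p z p∉z))
      where
      p∉x′ : p ∉ toggle p x
      p∉x′ p∈x′ = ∈-toggle⇒∉ p∈x′ p∈x
      below-p : toggle p x ⊆ z → ∀ q → q ∉ z → q ≼ p → q ≡ p
      below-p x′⊆z q q∉z q≼p with q ≟ᶠ p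
      ... | yes q≡p = q≡p
      ... | no q≢p  = ⊥-elim (q∉z (x′⊆z (∈-toggle⁺ q≢p (x-ideal p q q≼p p∈x))))

    ∑⊇-toggle : ∀ y (G : Subset n → ℕ) → ∑[ z ⊇ y ] isMaxOf? p z · G (toggle p z)
                                        ≡ ∑[ z ∈ J ] isMinOfCompl? p z · (y ⊆? toggle p z) · G z
    ∑⊇-toggle y G = begin
      ∑[ z ∈ J ] (y ⊆? z) · isMaxOf? p z · G (toggle p z)
        ≡⟨ ∑-cong J (λ {z} _ → ·-comm (y ⊆? z) (isMaxOf? p z)) ⟩
      ∑[ z ∈ J ] isMaxOf? p z · (y ⊆? z) · G (toggle p z)
        ≡⟨ ∑J-toggle p _ ⟩
      ∑[ z ∈ J ] isMinOfCompl? p z · (y ⊆? toggle p z) · G (toggle p (toggle p z))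
        ≡⟨ ∑-cong J (λ {z} _ → cong (λ w → isMinOfCompl? p z · (y ⊆? toggle p z) · G w)
                                    (toggle-involutive p z)) ⟩
      ∑[ z ∈ J ] isMinOfCompl? p z · (y ⊆? toggle p z) · G z ∎

    #chains-toggle : ∀ m {x} → IsIdeal x → IsMaxOf p x →
                     #chains m x + Max.#positions m x ≡ #chains m (toggle p x)
    #chains-toggle zero    {x} _ _ = trans (cong₂ _+_ (chainSum-zero x (λ _ → 1)) (Max.#positions-zero x))
                                           (sym (chainSum-zero (toggle p x) (λ _ → 1)))
    #chains-toggle (suc m) {x} x-ideal (p∈x , _) = begin
      #chains (suc m) x + Max.#positions (suc m) x
        ≡⟨ cong₂ _+_ (chainSum-suc m x _) (Max.#positions-suc m x) ⟩
      C⊇x + (∑[ z ⊇ x ] (isMaxOf? p z · #chains m z + Max.#positions m z))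
        ≡⟨ cong (C⊇x +_) (∑⊇-cong x (λ z z-ideal x⊆z → last-entry z z-ideal x⊆z (isMaxOf? p z))) ⟩
      C⊇x + (∑[ z ⊇ x ] isMaxOf? p z · #chains m (toggle p z))
        ≡⟨ cong (C⊇x +_) (∑⊇-toggle x (#chains m)) ⟩
      C⊇x + (∑[ z ∈ J ] isMinOfCompl? p z · (x ⊆? toggle p z) · #chains m z)
        ≡⟨ cong (C⊇x +_) (∑-cong J (λ {z} _ → ··-cong (minOfCompl×⊆⇔ x-ideal p∈x)
             (isMinOfCompl? p z) (x ⊆? toggle p z) (x′ ⊆? z) (¬? (p ∈? z)))) ⟩
      C⊇x + (∑[ z ∈ J ] (x′ ⊆? z) · ¬? (p ∈? z) · #chains m z)
        ≡⟨ ∑-+ J _ _ ⟨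
      ∑[ z ∈ J ] ((x ⊆? z) · #chains m z + (x′ ⊆? z) · ¬? (p ∈? z) · #chains m z)
        ≡⟨ ∑-cong J (λ {z} _ → split-at-p z) ⟨
      ∑[ z ⊇ x′ ] #chains m z
        ≡⟨ chainSum-suc m x′ _ ⟨
      #chains (suc m) x′ ∎
      where
      x′ : Subset n
      x′ = toggle p x
      C⊇x : ℕ
      C⊇x = ∑[ z ⊇ x ] #chains m z
      last-entry : ∀ z → IsIdeal z → x ⊆ z → (p-max? : Dec (IsMaxOf p z)) →
                   p-max? · #chains m z + Max.#positions m z ≡ p-max? · #chains m (toggle p z)
      last-entry z z-ideal x⊆z (yes p-max) = #chains-toggle m z-ideal p-max
      last-entry z z-ideal x⊆z (no ¬p-max) =
        Max.#positions-vanish m (λ w _ z⊆w p-max → ¬p-max (maxOf-⊆ z⊆w (x⊆z p∈x) p-max))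
      split-at-p : ∀ z → (x′ ⊆? z) · #chains m z
                         ≡ (x ⊆? z) · #chains m z + (x′ ⊆? z) · ¬? (p ∈? z) · #chains m z
      split-at-p z = trans (·-split (x′ ⊆? z) (p ∈? z))
        (cong (_+ (x′ ⊆? z) · ¬? (p ∈? z) · #chains m z)
              (·-cong (⇔-sym (⊆⇔toggle-⊆×∈ p∈x)) ((x′ ⊆? z) ×-dec (p ∈? z)) (x ⊆? z)))

    #positions-max≡min : ∀ m {y} → p ∉ y → Max.#positions m y ≡ Min.#positions m y
    #positions-max≡min zero    {y} _   = trans (Max.#positions-zero y) (sym (Min.#positions-zero y))
    #positions-max≡min (suc m) {y} p∉y = begin
      Max.#positions (suc m) y
        ≡⟨ Max.#positions-suc m y ⟩
      ∑[ z ⊇ y ] (isMaxOf? p z · #chains m z + Max.#positions m z)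
        ≡⟨ ∑⊇-cong y (λ z z-ideal _ → max-side z z-ideal (p ∈? z) (isMaxOf? p z)) ⟩
      ∑[ z ⊇ y ] (isMaxOf? p z · #chains m (toggle p z) + ¬? (p ∈? z) · Min.#positions m z)
        ≡⟨ ∑⊇-+ y _ _ ⟩
      (∑[ z ⊇ y ] isMaxOf? p z · #chains m (toggle p z)) + Rest
        ≡⟨ cong (_+ Rest) (∑⊇-toggle y (#chains m)) ⟩
      (∑[ z ∈ J ] isMinOfCompl? p z · (y ⊆? toggle p z) · #chains m z) + Rest
        ≡⟨ cong (_+ Rest) (∑-cong J (λ {z} _ → trans
             (cong (isMinOfCompl? p z ·_) (·-cong (⊆-toggle⇔ p∉y) (y ⊆? toggle p z) (y ⊆? z)))
             (·-comm (isMinOfCompl? p z) (y ⊆? z)))) ⟩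
      (∑[ z ⊇ y ] isMinOfCompl? p z · #chains m z) + Rest
        ≡⟨ ∑⊇-+ y _ _ ⟨
      ∑[ z ⊇ y ] (isMinOfCompl? p z · #chains m z + ¬? (p ∈? z) · Min.#positions m z)
        ≡⟨ ∑⊇-cong y (λ z _ _ → min-side z (p ∈? z)) ⟩
      ∑[ z ⊇ y ] (isMinOfCompl? p z · #chains m z + Min.#positions m z)
        ≡⟨ Min.#positions-suc m y ⟨
      Min.#positions (suc m) y ∎
      where
      Rest : ℕ
      Rest = ∑[ z ⊇ y ] ¬? (p ∈? z) · Min.#positions m z
      max-side : ∀ z → IsIdeal z → (p∈? : Dec (p ∈ z)) (p-max? : Dec (IsMaxOf p z)) →
                 p-max? · #chains m z + Max.#positions m z
                 ≡ p-max? · #chains m (toggle p z) + ¬? p∈? · Min.#positions m z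
      max-side z z-ideal (no p∉z)  (yes p-max) = ⊥-elim (p∉z (proj₁ p-max))
      max-side z z-ideal (no p∉z)  (no _)      = #positions-max≡min m p∉z
      max-side z z-ideal (yes _)   (yes p-max) = trans (#chains-toggle m z-ideal p-max) (sym (+-identityʳ _))
      max-side z z-ideal (yes p∈z) (no ¬p-max) =
        Max.#positions-vanish m (λ w _ z⊆w p-max → ¬p-max (maxOf-⊆ z⊆w p∈z p-max))
      min-side : ∀ z (p∈? : Dec (p ∈ z)) →
                 isMinOfCompl? p z · #chains m z + ¬? p∈? · Min.#positions m z
                 ≡ isMinOfCompl? p z · #chains m z + Min.#positions m z
      min-side z (no _)    = refl
      min-side z (yes p∈z) = cong (isMinOfCompl? p z · #chains m z +_)
        (sym (Min.#positions-vanish m (λ w _ z⊆w (p∉w , _) → p∉w (z⊆w p∈z))))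

    #members-max≡min : ∀ m → Max.#members m ⊥ ≡ Min.#members m ⊥
    #members-max≡min zero    = trans (Max.#members-zero ⊥) (sym (Min.#members-zero ⊥))
    #members-max≡min (suc m) = +-cancelʳ-≡ (Max.#positions m ⊥) _ _ (begin
      Max.#members (suc m) ⊥ + Max.#positions m ⊥
        ≡⟨ Max.#members+#positions m ⊥ ⟩
      Max.#positions (suc m) ⊥
        ≡⟨ #positions-max≡min (suc m) ∉⊥ ⟩
      Min.#positions (suc m) ⊥
        ≡⟨ Min.#members+#positions m ⊥ ⟨
      Min.#members (suc m) ⊥ + Min.#positions m ⊥
        ≡⟨ cong (Min.#members (suc m) ⊥ +_) (#positions-max≡min m ∉⊥) ⟨
      Min.#members (suc m) ⊥ + Max.#positions m ⊥ ∎)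

proposition2p5 : (n : ℕ) (_≼_ : Rel (Fin n) 0ℓ) (po : IsDecPartialOrder _≡_ _≼_)
                 (m : ℕ) → m ≥ 1 → Poset.ToggleSymmetric po (Poset.Ω po m)
proposition2p5 n _≼_ po m _ p = begin
  sumℚ (map (Ω m) max-ideals)            ≡⟨ ∑-/ℕ max-ideals (weight m) (totalWeight m) ⟩
  ∑ max-ideals (weight m) /ℕ totalWeight m ≡⟨ cong (_/ℕ totalWeight m) weights ⟩
  ∑ min-ideals (weight m) /ℕ totalWeight m ≡⟨ ∑-/ℕ min-ideals (weight m) (totalWeight m) ⟨
  sumℚ (map (Ω m) min-ideals)            ∎
  where
  open Poset po
  open Toggle po p
  max-ideals min-ideals : List (Subset n)
  max-ideals = filter (isMaxOf? p) J
  min-ideals = filter (isMinOfCompl? p) J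
  weights : ∑ max-ideals (weight m) ≡ ∑ min-ideals (weight m)
  weights = begin
    ∑ max-ideals (weight m)  ≡⟨ Max.∑-weight m ⟩
    Max.#members m ⊥         ≡⟨ #members-max≡min m ⟩
    Min.#members m ⊥         ≡⟨ Min.∑-weight m ⟨
    ∑ min-ideals (weight m)  ∎
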